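{- Let $q\geq3$, $n\geq2$, and let $\langle v_0,v_1,\dots,v_n\rangle$ with $v_0=\infty$ be the path of convergents of the Rosen continued fraction $[b_1,\dots,b_n]_q$. Then $\phi(v_{i-2},v_{i-1},v_i)=b_i$ for $i=2,\dots,n$.
   Context: Let $\lambda_q=2\cos(\pi/q)$ and $G_q$ the group of Möbius transformations generated by $\sigma(z)=-1/z$, $\tau(z)=z+\lambda_q$. The Farey graph $\mathcal{F}_q$ has vertex set $G_q(\infty)\subset\mathbb{R}\cup\{\infty\}$, with $u\sim v$ iff $\{u,v\}=\{g(0),g(\infty)\}$ for some $g\in G_q$; the neighbours of $\infty$ are the integer multiples of $\lambda_q$. For vertices $a\sim b\sim c$ define $\phi(a,b,c)$: if $b=\infty$, $\phi(a,\infty,c)=(c-a)/\lambda_q$; otherwise $\phi(a,b,c)=\phi(f(a),f(b),f(c))$ for any $f\in G_q$ with $f(b)=\infty$ (independent of the choice of $f$). For integers $b_1,\dots,b_n$ with $s_i(z)=b_i\lambda_q-1/z$, the convergents of $[b_1,\dots,b_n]_q$ are $v_m=s_1\circ\dots\circ s_m(\infty)$, and its path of convergents is $\langle\infty,v_1,\dots,v_n\rangle$. -}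

module Defs where

open import Level using (_⊔_)
open import Algebra.Bundles using (CommutativeRing)
open import Data.Nat as ℕ using (ℕ; zero; suc)
open import Data.Integer as ℤ using (ℤ; +_; -[1+_])
open import Data.List using (List; []; _∷_; take)
open import Data.Product using (_×_; _,_; Σ; proj₁; proj₂)
open import Data.Sum using (_⊎_)
open import Relation.Nullary using (¬_)

-- Everything is parametrised by an (integral-domain) commutative ring R
-- and an element lam of R playing the role of λ_q = 2cos(π/q).
module Rosen {c ℓ} (R : CommutativeRing c ℓ) where
  open CommutativeRing R

  natMul : ℕ → Carrier → Carrier
  natMul zero    x = 0#
  natMul (suc n) x = x + natMul n x

  intMul : ℤ → Carrier → Carrier
  intMul (+ n)      x = natMul n x
  intMul -[1+ n ]   x = - natMul (suc n) x

  pow : Carrier → ℕ → Carrier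
  pow x zero    = 1#
  pow x (suc n) = x * pow x n

  IsIntegralDomainChar0 : Set (c ⊔ ℓ)
  IsIntegralDomainChar0 =
    ¬ (1# ≈ 0#)
    × (∀ x y → x * y ≈ 0# → (x ≈ 0#) ⊎ (y ≈ 0#))
    × (∀ n → ¬ (natMul (suc n) 1# ≈ 0#))

  IsPrimitiveRoot : ℕ → Carrier → Set ℓ
  IsPrimitiveRoot m ζ =
    pow ζ m ≈ 1# × (∀ k → 0 ℕ.< k → k ℕ.< m → ¬ (pow ζ k ≈ 1#))

  -- Points of the projective line P¹(R) in homogeneous coordinates (x : y);
  -- (x : y) stands for x/y, and ∞ = (1 : 0).
  Point : Set c
  Point = Carrier × Carrier

  ∞ : Point
  ∞ = 1# , 0#

  module WithLambda (lam : Carrier) where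

    -- generators of G_q (and the inverse of τ; σ is an involution on P¹)
    data Gen : Set where
      σ τ τ⁻¹ : Gen

    gen : Gen → Point → Point
    gen σ   (x , y) = (- y , x)
    gen τ   (x , y) = (x + lam * y , y)
    gen τ⁻¹ (x , y) = (x - lam * y , y)

    -- an element of G_q is represented by a word g₁ g₂ … gₖ, acting as g₁ ∘ … ∘ gₖ
    act : List Gen → Point → Point
    act []      p = p
    act (g ∷ w) p = gen g (act w p)

    s : ℤ → Point → Point
    s b (x , y) = (intMul b lam * x - y , x)

    conv : List ℤ → Point
    conv []       = ∞
    conv (b ∷ bs) = s b (conv bs)

    convergent : List ℤ → ℕ → Point
    convergent bs m = conv (take m bs)

    -- φ(a,b,c) = x : for some f ∈ G_q with f(b) = ∞ we have (f(c) - f(a))/λ = x.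
    -- (By the stated independence of the choice of f, this determines φ.)
    PhiIs : Point → Point → Point → ℤ → Set ℓ
    PhiIs a b c x = Σ (List Gen) λ w →
      let fa = act w a ; fb = act w b ; fc = act w c in
        (proj₂ fb ≈ 0#) × ¬ (proj₁ fb ≈ 0#)
        × ¬ (proj₂ fa ≈ 0#) × ¬ (proj₂ fc ≈ 0#)
        -- f(c) - f(a) = x λ, i.e. c₁/c₂ - a₁/a₂ = xλ, cleared of denominators
        × (proj₁ fc * proj₂ fa - proj₁ fa * proj₂ fc
             ≈ intMul x lam * (proj₂ fa * proj₂ fc))

{-# OPTIONS --safe #-}
module Submission where

-- Each s_b lies in G_q (as τ^b ∘ σ) and φ is G_q-invariant, while
-- the convergents of [b₁,…,bₙ] are s_{b₁} applied to those of [b₂,…,bₙ]; so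
-- φ(v_{i-2},v_{i-1},v_i) for [b₁,…,bₙ] equals the corresponding value for
-- [b₂,…,bₙ], and induction reduces to i = 2. There v₀ = ∞ = s_{b₁}(0) and
-- φ(0,∞,s_{b₂}(∞)) = (b₂λ − 0)/λ = b₂ is read off at b = ∞ directly.

open import Defs
open import Algebra.Bundles using (CommutativeRing)
open import Data.Nat using (ℕ; zero; suc; _∸_; _≤_; s≤s; z≤n)
open import Data.Integer using (ℤ; +_; -[1+_])
open import Data.List using (List; []; _∷_; _++_; replicate; length; lookup)
open import Data.Fin as Fin using (Fin; toℕ)
open import Data.Product using (_×_; _,_; proj₁; proj₂)
open import Data.Product.Relation.Binary.Pointwise.NonDependent
  using (Pointwise; ×-isEquivalence)
open import Relation.Binary.Structures using (IsEquivalence)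
open import Relation.Nullary using (¬_)
import Relation.Binary.PropositionalEquality as ≡

module PhiOfConvergents {c ℓ} (R : CommutativeRing c ℓ) (lam : CommutativeRing.Carrier R) where
  open CommutativeRing R
  open import Algebra.Properties.Ring ring using (-0#≈0#; -‿involutive; -‿anti-homo-+; -‿distribˡ-*; xyx⁻¹≈y)
  open import Relation.Binary.Reasoning.Setoid setoid
  open Rosen R
  open WithLambda lam

  infix 4 _≋_
  _≋_ : Point → Point → Set ℓ
  _≋_ = Pointwise _≈_ _≈_

  open IsEquivalence (×-isEquivalence isEquivalence isEquivalence)
    using () renaming (refl to ≋-refl; sym to ≋-sym; trans to ≋-trans; reflexive to ≋-reflexive)

  gen-cong : ∀ g {p p′} → p ≋ p′ → gen g p ≋ gen g p′
  gen-cong σ   (x≈ , y≈) = -‿cong y≈ , x≈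
  gen-cong τ   (x≈ , y≈) = +-cong x≈ (*-congˡ y≈) , y≈
  gen-cong τ⁻¹ (x≈ , y≈) = +-cong x≈ (-‿cong (*-congˡ y≈)) , y≈

  act-cong : ∀ w {p p′} → p ≋ p′ → act w p ≋ act w p′
  act-cong []      p≋p′ = p≋p′
  act-cong (g ∷ w) p≋p′ = gen-cong g (act-cong w p≋p′)

  act-++ : ∀ u v p → act (u ++ v) p ≡.≡ act u (act v p)
  act-++ []      v p = ≡.refl
  act-++ (g ∷ u) v p = ≡.cong (gen g) (act-++ u v p)

  act-τ^ : ∀ n x y → act (replicate n τ) (x , y) ≋ (x + natMul n lam * y , y)
  act-τ^ zero    x y = sym (trans (+-congˡ (zeroˡ y)) (+-identityʳ x)) , refl
  act-τ^ (suc n) x y = first , proj₂ (act-τ^ n x y)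
    where
    first : proj₁ (act (replicate (suc n) τ) (x , y)) ≈ x + natMul (suc n) lam * y
    first = begin
      proj₁ (act (replicate n τ) (x , y)) + lam * proj₂ (act (replicate n τ) (x , y))
        ≈⟨ +-cong (proj₁ (act-τ^ n x y)) (*-congˡ (proj₂ (act-τ^ n x y))) ⟩
      x + natMul n lam * y + lam * y   ≈⟨ +-assoc x _ _ ⟩
      x + (natMul n lam * y + lam * y) ≈⟨ +-congˡ (+-comm _ _) ⟩
      x + (lam * y + natMul n lam * y) ≈⟨ +-congˡ (distribʳ y lam (natMul n lam)) ⟨
      x + natMul (suc n) lam * y       ∎

  act-τ⁻¹^ : ∀ n x y → act (replicate n τ⁻¹) (x , y) ≋ (x - natMul n lam * y , y)
  act-τ⁻¹^ zero    x y = sym (trans (+-congˡ (trans (-‿cong (zeroˡ y)) -0#≈0#)) (+-identityʳ x)) , refl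
  act-τ⁻¹^ (suc n) x y = first , proj₂ (act-τ⁻¹^ n x y)
    where
    first : proj₁ (act (replicate (suc n) τ⁻¹) (x , y)) ≈ x - natMul (suc n) lam * y
    first = begin
      proj₁ (act (replicate n τ⁻¹) (x , y)) - lam * proj₂ (act (replicate n τ⁻¹) (x , y))
        ≈⟨ +-cong (proj₁ (act-τ⁻¹^ n x y)) (-‿cong (*-congˡ (proj₂ (act-τ⁻¹^ n x y)))) ⟩
      x - natMul n lam * y - lam * y       ≈⟨ +-assoc x _ _ ⟩
      x + (- (natMul n lam * y) - lam * y) ≈⟨ +-congˡ (-‿anti-homo-+ (lam * y) (natMul n lam * y)) ⟨
      x - (lam * y + natMul n lam * y)     ≈⟨ +-congˡ (-‿cong (distribʳ y lam (natMul n lam))) ⟨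
      x - natMul (suc n) lam * y           ∎

  τ^- : ℤ → List Gen
  τ^- (+ n)    = replicate n τ⁻¹
  τ^- -[1+ n ] = replicate (suc n) τ

  act-τ^- : ∀ k x y → act (τ^- k) (x , y) ≋ (x - intMul k lam * y , y)
  act-τ^- (+ n)    x y = act-τ⁻¹^ n x y
  act-τ^- -[1+ n ] x y = ≋-trans (act-τ^ (suc n) x y) (+-congˡ negate-twice , refl)
    where
    negate-twice : natMul (suc n) lam * y ≈ - (- natMul (suc n) lam * y)
    negate-twice = trans (sym (-‿involutive _)) (-‿cong (-‿distribˡ-* _ y))

  -- On homogeneous coordinates σ² is −id rather than id, so σ³ is the exact
  -- inverse of σ.
  s⁻¹ : ℤ → List Gen
  s⁻¹ b = σ ∷ σ ∷ σ ∷ τ^- b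

  act-s⁻¹-s : ∀ b p → act (s⁻¹ b) (s b p) ≋ p
  act-s⁻¹-s b (x , y) =
    ≋-trans (gen-cong σ (gen-cong σ (gen-cong σ (act-τ^- b (bx - y) x))))
            (-‿involutive x , trans (-‿cong (xyx⁻¹≈y bx (- y))) (-‿involutive y))
    where bx = intMul b lam * x

  -- The point 0 is taken as (0 : −1) so that s_b sends it to ∞ = (1 : 0) on the nose.
  s-origin≋∞ : ∀ b → s b (0# , - 1#) ≋ ∞
  s-origin≋∞ b = trans (+-cong (zeroʳ _) (-‿involutive 1#)) (+-identityˡ 1#) , refl

  PhiAt∞ : Point → Point → Point → ℤ → Set ℓ
  PhiAt∞ (a₁ , a₂) (b₁ , b₂) (c₁ , c₂) k =
    (b₂ ≈ 0#) × ¬ (b₁ ≈ 0#) × ¬ (a₂ ≈ 0#) × ¬ (c₂ ≈ 0#)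
    × (c₁ * a₂ - a₁ * c₂ ≈ intMul k lam * (a₂ * c₂))

  PhiAt∞-cong : ∀ {a a′ b b′ c c′} k → a ≋ a′ → b ≋ b′ → c ≋ c′ →
                PhiAt∞ a b c k → PhiAt∞ a′ b′ c′ k
  PhiAt∞-cong k (a₁≈ , a₂≈) (b₁≈ , b₂≈) (c₁≈ , c₂≈) (b₂≈0 , b₁≉0 , a₂≉0 , c₂≉0 , eq) =
    trans (sym b₂≈) b₂≈0 , (λ e → b₁≉0 (trans b₁≈ e)) , (λ e → a₂≉0 (trans a₂≈ e)) ,
    (λ e → c₂≉0 (trans c₂≈ e)) ,
    trans (sym (+-cong (*-cong c₁≈ a₂≈) (-‿cong (*-cong a₁≈ c₂≈))))
          (trans eq (*-congˡ (*-cong a₂≈ c₂≈)))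

  PhiIs-cong : ∀ {a a′ b b′ c c′} k → a ≋ a′ → b ≋ b′ → c ≋ c′ →
               PhiIs a b c k → PhiIs a′ b′ c′ k
  PhiIs-cong k a≋ b≋ c≋ (w , φ) =
    w , PhiAt∞-cong k (act-cong w a≋) (act-cong w b≋) (act-cong w c≋) φ

  PhiIs-s : ∀ x {a b c} k → PhiIs a b c k → PhiIs (s x a) (s x b) (s x c) k
  PhiIs-s x k (w , φ) = w ++ s⁻¹ x , PhiAt∞-cong k (undo _) (undo _) (undo _) φ
    where
    undo : ∀ p → act w p ≋ act (w ++ s⁻¹ x) (s x p)
    undo p = ≋-trans (act-cong w (≋-sym (act-s⁻¹-s x p)))
                     (≋-reflexive (≡.sym (act-++ w (s⁻¹ x) (s x p))))

  PhiIs-origin-∞-s : ¬ (1# ≈ 0#) → ∀ k → PhiIs (0# , - 1#) ∞ (s k ∞) k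
  PhiIs-origin-∞-s 1≉0 k = [] , refl , 1≉0 , -1≉0 , 1≉0 , difference
    where
    K = intMul k lam
    -1≉0 : ¬ (- 1# ≈ 0#)
    -1≉0 e = 1≉0 (trans (sym (-‿involutive 1#)) (trans (-‿cong e) -0#≈0#))
    difference : (K * 1# - 0#) * - 1# - 0# * 1# ≈ K * (- 1# * 1#)
    difference = begin
      (K * 1# - 0#) * - 1# - 0# * 1# ≈⟨ +-congˡ (trans (-‿cong (zeroˡ 1#)) -0#≈0#) ⟩
      (K * 1# - 0#) * - 1# + 0#      ≈⟨ +-identityʳ _ ⟩
      (K * 1# - 0#) * - 1#           ≈⟨ *-congʳ (trans (+-congˡ -0#≈0#) (+-identityʳ _)) ⟩
      K * 1# * - 1#                  ≈⟨ *-congʳ (*-identityʳ K) ⟩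
      K * - 1#                       ≈⟨ *-congˡ (*-identityʳ (- 1#)) ⟨
      K * (- 1# * 1#)                ∎

  PhiIs-convergents : ¬ (1# ≈ 0#) → (bs : List ℤ) (i : Fin (length bs)) → 1 ≤ toℕ i →
    PhiIs (convergent bs (toℕ i ∸ 1)) (convergent bs (toℕ i)) (convergent bs (suc (toℕ i)))
          (lookup bs i)
  PhiIs-convergents 1≉0 (x ∷ [])           (Fin.suc ())
  PhiIs-convergents 1≉0 (x ∷ y ∷ _)        (Fin.suc Fin.zero) _ =
    PhiIs-cong y (s-origin≋∞ x) ≋-refl ≋-refl (PhiIs-s x y (PhiIs-origin-∞-s 1≉0 y))
  PhiIs-convergents 1≉0 (x ∷ bs@(_ ∷ _)) (Fin.suc (Fin.suc i)) _ =
    PhiIs-s x (lookup bs (Fin.suc i)) (PhiIs-convergents 1≉0 bs (Fin.suc i) (s≤s z≤n))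

open import Data.Nat using (_*_)

lemma7 : ∀ {c ℓ} (R : CommutativeRing c ℓ)
           → Rosen.IsIntegralDomainChar0 R
           → (q : ℕ) → 3 ≤ q
           → (ζ : CommutativeRing.Carrier R)
           → Rosen.IsPrimitiveRoot R (2 * q) ζ
           → let lam = CommutativeRing._+_ R ζ (Rosen.pow R ζ (2 * q ∸ 1)) in
             (bs : List ℤ) → 2 ≤ length bs
           → (i : Fin (length bs)) → 1 ≤ toℕ i
           → Rosen.WithLambda.PhiIs R lam
               (Rosen.WithLambda.convergent R lam bs (toℕ i ∸ 1))
               (Rosen.WithLambda.convergent R lam bs (toℕ i))
               (Rosen.WithLambda.convergent R lam bs (suc (toℕ i)))
               (lookup bs i)
lemma7 R (1≉0 , _) q _ ζ _ bs _ =
  PhiOfConvergents.PhiIs-convergents R (CommutativeRing._+_ R ζ (Rosen.pow R ζ (2 * q ∸ 1))) 1≉0 bs
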